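{- Let $p$ be a prime, $q=p^a$ ($a\ge1$), $k\ge1$, let $m>0$ be an integer written $m=lq^k+s$ with $0\le s<q^k$, $l\ge0$, and let $1\le n<q^k$. Then $$\sum_{r=n}^{q^k-1}\binom{r}{n}\binom{m+r-1}{r}\equiv\begin{cases}(-1)^n \pmod p & \text{if } n+s=q^k,\\ 0\pmod p & \text{otherwise.}\end{cases}$$ -}

module Defs where

open import Data.Nat using (ℕ; zero; suc; _+_)

sumFrom : ℕ → ℕ → (ℕ → ℕ) → ℕ
sumFrom a zero    f = 0
sumFrom a (suc len) f = f a + sumFrom (suc a) len f

{-# OPTIONS --safe #-}
-- Trinomial revision followed by the hockey-stick identity collapses the sum to the product
-- C(m+n-1, n) · C(m+Q-1, Q-n-1), where Q = q^k.  Because p divides C(Q, i) for 0 < i < Q,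
-- Pascal's rule gives C(lQ + x, j) ≡ C(x, j) and C(Q-1, j) ≡ (-1)^j (mod p) for j < Q.
-- Reducing the two factors this way, the product vanishes mod p unless n + s = Q, when the
-- first factor becomes C(Q-1, n) and the second C(s-1, s-1) = 1.
module Submission where

open import Defs

module BinomialIdentities where

  open import Data.Nat
  open import Data.Nat.Properties
  open import Data.Nat.Combinatorics
  open import Data.Nat.DivMod using (m/n*n≡m)
  open import Data.Nat.Divisibility using (_∣_; divides; _∣0)
  open import Data.Nat.Tactic.RingSolver using (solve-∀)
  open import Relation.Binary.PropositionalEquality
  open import Relation.Nullary using (yes; no)
  open ≡-Reasoning

  nCk*[k!*[n∸k]!]≡n! : ∀ {n k} → k ≤ n → (n C k) * (k ! * (n ∸ k) !) ≡ n !
  nCk*[k!*[n∸k]!]≡n! {n} {k} k≤n =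
    trans (cong (_* (k ! * (n ∸ k) !)) (nCk≡n!/k![n-k]! k≤n)) (m/n*n≡m {{k !* (n ∸ k) !≢0}} (k![n∸k]!∣n! k≤n))

  [m+n]Cm*[m!*n!]≡[m+n]! : ∀ m n → ((m + n) C m) * (m ! * n !) ≡ (m + n) !
  [m+n]Cm*[m!*n!]≡[m+n]! m n =
    subst (λ t → ((m + n) C m) * (m ! * t !) ≡ (m + n) !) (m+n∸m≡n m n) (nCk*[k!*[n∸k]!]≡n! (m≤m+n m n))

  [m+n]Cn*[m!*n!]≡[m+n]! : ∀ m n → ((m + n) C n) * (m ! * n !) ≡ (m + n) !
  [m+n]Cn*[m!*n!]≡[m+n]! m n rewrite +-comm m n | *-comm (m !) (n !) = [m+n]Cm*[m!*n!]≡[m+n]! n m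

  -- Both sides equal (c + n + j)! / (c! n! j!).
  trinomial-revision : ∀ c n j →
    ((n + j) C n) * ((c + (n + j)) C (n + j)) ≡ ((c + n) C n) * ((c + n + j) C j)
  trinomial-revision c n j = *-cancelʳ-≡ _ _ (n ! * (j ! * c !)) {{n!*[j!*c!]≢0}} (begin
    A * B * (n ! * (j ! * c !))        ≡⟨ regroupˡ A B (n !) (j !) (c !) ⟩
    B * (c ! * (A * (n ! * j !)))      ≡⟨ cong (λ t → B * (c ! * t)) ([m+n]Cm*[m!*n!]≡[m+n]! n j) ⟩
    B * (c ! * (n + j) !)              ≡⟨ [m+n]Cn*[m!*n!]≡[m+n]! c (n + j) ⟩
    (c + (n + j)) !                    ≡⟨ cong _! (+-assoc c n j) ⟨
    (c + n + j) !                      ≡⟨ [m+n]Cn*[m!*n!]≡[m+n]! (c + n) j ⟨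
    B′ * ((c + n) ! * j !)             ≡⟨ cong (λ t → B′ * (t * j !)) ([m+n]Cn*[m!*n!]≡[m+n]! c n) ⟨
    B′ * ((A′ * (c ! * n !)) * j !)    ≡⟨ regroupʳ A′ B′ (n !) (j !) (c !) ⟨
    A′ * B′ * (n ! * (j ! * c !))      ∎)
    where
    A B A′ B′ : ℕ
    A = (n + j) C n
    B = (c + (n + j)) C (n + j)
    A′ = (c + n) C n
    B′ = (c + n + j) C j
    n!*[j!*c!]≢0 : NonZero (n ! * (j ! * c !))
    n!*[j!*c!]≢0 = m*n≢0 _ _ {{n !≢0}} {{j !* c !≢0}}
    regroupˡ : ∀ a b x y z → a * b * (x * (y * z)) ≡ b * (z * (a * (x * y)))
    regroupˡ = solve-∀
    regroupʳ : ∀ a b x y z → a * b * (x * (y * z)) ≡ b * ((a * (z * x)) * y)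
    regroupʳ = solve-∀

  absorption : ∀ n k → suc k * (suc n C suc k) ≡ suc n * (n C k)
  absorption n k with k ≤? n
  ... | no k≰n rewrite k>n⇒nCk≡0 (≰⇒> k≰n) | k>n⇒nCk≡0 (s<s (≰⇒> k≰n)) | *-zeroʳ (suc k) = sym (*-zeroʳ (suc n))
  ... | yes k≤n = *-cancelʳ-≡ _ _ (k ! * (n ∸ k) !) {{k !* (n ∸ k) !≢0}} (begin
    suc k * X * (k ! * (n ∸ k) !)    ≡⟨ regroup (suc k) X (k !) ((n ∸ k) !) ⟩
    X * (suc k ! * (n ∸ k) !)        ≡⟨ nCk*[k!*[n∸k]!]≡n! (s≤s k≤n) ⟩
    suc n !                          ≡⟨ cong (suc n *_) (nCk*[k!*[n∸k]!]≡n! k≤n) ⟨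
    suc n * (Y * (k ! * (n ∸ k) !))  ≡⟨ *-assoc (suc n) Y _ ⟨
    suc n * Y * (k ! * (n ∸ k) !)    ∎)
    where
    X Y : ℕ
    X = suc n C suc k
    Y = n C k
    regroup : ∀ a b c d → a * b * (c * d) ≡ b * ((a * c) * d)
    regroup = solve-∀

  n∣k*nCk : ∀ n k → n ∣ k * (n C k)
  n∣k*nCk zero    zero    = 0 ∣0
  n∣k*nCk zero    (suc k) = subst (0 ∣_) (sym (*-zeroʳ (suc k))) (0 ∣0)
  n∣k*nCk (suc n) zero    = suc n ∣0
  n∣k*nCk (suc n) (suc k) = divides (n C k) (trans (absorption n k) (*-comm (suc n) (n C k)))

  sumFrom-snoc : ∀ a len f → sumFrom a (suc len) f ≡ sumFrom a len f + f (a + len)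
  sumFrom-snoc a zero      f rewrite +-identityʳ a = +-identityʳ (f a)
  sumFrom-snoc a (suc len) f rewrite sumFrom-snoc (suc a) len f | +-suc a len = sym (+-assoc (f a) _ _)

  sum-binomial-product : ∀ c n J →
    sumFrom n (suc J) (λ r → (r C n) * ((c + r) C r)) ≡ ((c + n) C n) * ((c + n + suc J) C J)
  sum-binomial-product c n zero = begin
    (n C n) * ((c + n) C n) + 0 ≡⟨ +-identityʳ _ ⟩
    (n C n) * ((c + n) C n)     ≡⟨ cong (_* ((c + n) C n)) (nCn≡1 n) ⟩
    1 * ((c + n) C n)           ≡⟨ *-comm 1 _ ⟩
    ((c + n) C n) * 1           ∎
  sum-binomial-product c n (suc J) = begin
    sumFrom n (suc (suc J)) f                                ≡⟨ sumFrom-snoc n (suc J) f ⟩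
    sumFrom n (suc J) f + f (n + suc J)                      ≡⟨ cong₂ _+_ (sum-binomial-product c n J) (trinomial-revision c n (suc J)) ⟩
    A * ((c + n + suc J) C J) + A * ((c + n + suc J) C suc J) ≡⟨ *-distribˡ-+ A _ _ ⟨
    A * ((c + n + suc J) C J + (c + n + suc J) C suc J)      ≡⟨ cong (A *_) (nCk+nC[k+1]≡[n+1]C[k+1] (c + n + suc J) J) ⟩
    A * (suc (c + n + suc J) C suc J)                        ≡⟨ cong (λ t → A * (t C suc J)) (+-suc (c + n) (suc J)) ⟨
    A * ((c + n + suc (suc J)) C suc J)                      ∎
    where
    f : ℕ → ℕ
    f r = (r C n) * ((c + r) C r)
    A : ℕ
    A = (c + n) C n

module PrimePowerBinomials where

  open import Data.Nat
  open import Data.Nat.Properties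
  open import Data.Nat.Combinatorics using (_C_)
  open import Data.Nat.Divisibility
  open import Data.Nat.Primality using (Prime; euclidsLemma; prime⇒nonZero)
  open import Data.Sum using (inj₁; inj₂)
  open import Relation.Binary.PropositionalEquality
  open import Relation.Nullary using (¬_; yes; no; contradiction)
  open BinomialIdentities using (n∣k*nCk)

  p^e∣m*n∧p∤n⇒p^e∣m : ∀ {p} → Prime p → ∀ e m n → p ^ e ∣ m * n → ¬ p ∣ n → p ^ e ∣ m
  p^e∣m*n∧p∤n⇒p^e∣m pp zero m n _ _ = 1∣ m
  p^e∣m*n∧p∤n⇒p^e∣m {p} pp (suc e) m n p^[1+e]∣m*n p∤n
    with euclidsLemma m n pp (∣-trans (m∣m*n (p ^ e)) p^[1+e]∣m*n)
  ... | inj₂ p∣n = contradiction p∣n p∤n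
  ... | inj₁ (divides q refl) = subst (p * p ^ e ∣_) (*-comm p q) (*-monoʳ-∣ p p^e∣q)
    where
    instance _ = prime⇒nonZero pp
    p^e∣q : p ^ e ∣ q
    p^e∣q = p^e∣m*n∧p∤n⇒p^e∣m pp e q n
      (*-cancelˡ-∣ p (subst (p * p ^ e ∣_) (trans (cong (_* n) (*-comm q p)) (*-assoc p q n)) p^[1+e]∣m*n)) p∤n

  p∣[p^e]Ck : ∀ {p} → Prime p → ∀ e {k} → 0 < k → k < p ^ e → p ∣ (p ^ e) C k
  p∣[p^e]Ck {p} pp e {k} 0<k k<p^e with p ∣? (p ^ e) C k
  ... | yes p∣ = p∣
  ... | no p∤ = contradiction (∣⇒≤ {{>-nonZero 0<k}} p^e∣k) (<⇒≱ k<p^e)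
    where
    p^e∣k : p ^ e ∣ k
    p^e∣k = p^e∣m*n∧p∤n⇒p^e∣m pp e k ((p ^ e) C k) (n∣k*nCk (p ^ e) k) p∤

module Congruence where

  open import Data.Nat.Base as ℕ using (ℕ)
  import Data.Nat.Divisibility as ℕ
  open import Data.Integer.Base
  open import Data.Integer.Properties using (+-identityʳ)
  open import Data.Integer.Divisibility.Signed
  open import Data.Integer.Tactic.RingSolver using (solve-∀)
  open import Relation.Binary.Bundles using (Setoid)
  open import Relation.Binary.Structures using (IsEquivalence)
  import Relation.Binary.Reasoning.Setoid
  open import Relation.Binary.PropositionalEquality using (_≡_; subst; sym)

  infix 4 _≡_mod_
  -- A record rather than a synonym for + n ∣ x - y, so that x and y stay inferable.
  record _≡_mod_ (x y : ℤ) (n : ℕ) : Set where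
    constructor mod-intro
    field n∣x-y : + n ∣ x - y
  open _≡_mod_ public

  module _ {n : ℕ} where

    ≡-mod-refl : ∀ {x} → x ≡ x mod n
    ≡-mod-refl {x} = mod-intro (subst (+ n ∣_) (x-x≡0 x) (∣n⇒∣m*n 0ℤ ∣-refl))
      where
      x-x≡0 : ∀ x → 0ℤ ≡ x - x
      x-x≡0 = solve-∀

    ≡-mod-sym : ∀ {x y} → x ≡ y mod n → y ≡ x mod n
    ≡-mod-sym {x} {y} (mod-intro n∣x-y) = mod-intro (subst (+ n ∣_) (-[x-y]≡y-x x y) (∣m⇒∣-m n∣x-y))
      where
      -[x-y]≡y-x : ∀ x y → - (x - y) ≡ y - x
      -[x-y]≡y-x = solve-∀

    ≡-mod-trans : ∀ {x y z} → x ≡ y mod n → y ≡ z mod n → x ≡ z mod n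
    ≡-mod-trans {x} {y} {z} (mod-intro n∣x-y) (mod-intro n∣y-z) =
      mod-intro (subst (+ n ∣_) (telescope x y z) (∣m∣n⇒∣m+n n∣x-y n∣y-z))
      where
      telescope : ∀ x y z → (x - y) + (y - z) ≡ x - z
      telescope = solve-∀

    ≡-mod-isEquivalence : IsEquivalence (λ x y → x ≡ y mod n)
    ≡-mod-isEquivalence = record { refl = ≡-mod-refl ; sym = ≡-mod-sym ; trans = ≡-mod-trans }

    +-cong-mod : ∀ {x x′ y y′} → x ≡ x′ mod n → y ≡ y′ mod n → x + y ≡ x′ + y′ mod n
    +-cong-mod {x} {x′} {y} {y′} (mod-intro n∣x-x′) (mod-intro n∣y-y′) =
      mod-intro (subst (+ n ∣_) (regroup x x′ y y′) (∣m∣n⇒∣m+n n∣x-x′ n∣y-y′))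
      where
      regroup : ∀ x x′ y y′ → (x - x′) + (y - y′) ≡ (x + y) - (x′ + y′)
      regroup = solve-∀

    *-cong-mod : ∀ {x x′ y y′} → x ≡ x′ mod n → y ≡ y′ mod n → x * y ≡ x′ * y′ mod n
    *-cong-mod {x} {x′} {y} {y′} (mod-intro n∣x-x′) (mod-intro n∣y-y′) =
      mod-intro (subst (+ n ∣_) (regroup x x′ y y′) (∣m∣n⇒∣m+n (∣n⇒∣m*n x n∣y-y′) (∣m⇒∣m*n y′ n∣x-x′)))
      where
      regroup : ∀ x x′ y y′ → x * (y - y′) + (x - x′) * y′ ≡ x * y - x′ * y′
      regroup = solve-∀

    neg-cong-mod : ∀ {x y} → x ≡ y mod n → - x ≡ - y mod n
    neg-cong-mod {x} {y} (mod-intro n∣x-y) = mod-intro (subst (+ n ∣_) (regroup x y) (∣m⇒∣-m n∣x-y))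
      where
      regroup : ∀ x y → - (x - y) ≡ - x - - y
      regroup = solve-∀

    ∣⇒≡0-mod : ∀ {x} → n ℕ.∣ x → + x ≡ 0ℤ mod n
    ∣⇒≡0-mod {x} n∣x = mod-intro (∣ᵤ⇒∣ (subst (λ t → n ℕ.∣ ∣ t ∣) (sym (+-identityʳ (+ x))) n∣x))

  ≡-mod-setoid : ℕ → Setoid _ _
  ≡-mod-setoid n = record { isEquivalence = ≡-mod-isEquivalence {n} }

  module ≡-mod-Reasoning (n : ℕ) = Relation.Binary.Reasoning.Setoid (≡-mod-setoid n)

module BinomialsModuloPrime where

  open import Data.Nat as ℕ using (ℕ; zero; suc; _<_; s≤s; z≤n)
  import Data.Nat.Properties as ℕ
  open import Data.Nat.Combinatorics using (_C_; nCk+nC[k+1]≡[n+1]C[k+1])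
  open import Data.Nat.Divisibility using (_∣_)
  open import Data.Integer.Base hiding (suc; _<_)
  open import Data.Integer.Properties using (pos-+; +-identityˡ; -1*i≡-i)
  open import Data.Integer.Tactic.RingSolver using (solve-∀)
  open import Relation.Binary.PropositionalEquality using (_≡_; refl; cong; subst)
  open Congruence

  pascal-ℤ : ∀ n k → + (suc n C suc k) ≡ + (n C k) + + (n C suc k)
  pascal-ℤ n k = subst (λ t → + t ≡ + (n C k) + + (n C suc k)) (nCk+nC[k+1]≡[n+1]C[k+1] n k) (pos-+ (n C k) (n C suc k))

  module _ {p Q : ℕ} (p∣QCk : ∀ {k} → 0 < k → k < Q → p ∣ Q C k) where

    open ≡-mod-Reasoning p

    [Q+n]Ck≡nCk : ∀ n {k} → k < Q → + ((Q ℕ.+ n) C k) ≡ + (n C k) mod p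
    [Q+n]Ck≡nCk zero    {zero}  _   = ≡-mod-refl
    [Q+n]Ck≡nCk zero    {suc k} k<Q rewrite ℕ.+-identityʳ Q = ∣⇒≡0-mod (p∣QCk (s≤s z≤n) k<Q)
    [Q+n]Ck≡nCk (suc n) {zero}  _   = ≡-mod-refl
    [Q+n]Ck≡nCk (suc n) {suc k} k<Q = begin
      + ((Q ℕ.+ suc n) C suc k)                  ≡⟨ cong (λ t → + (t C suc k)) (ℕ.+-suc Q n) ⟩
      + (suc (Q ℕ.+ n) C suc k)                  ≡⟨ pascal-ℤ (Q ℕ.+ n) k ⟩
      + ((Q ℕ.+ n) C k) + + ((Q ℕ.+ n) C suc k)  ≈⟨ +-cong-mod ([Q+n]Ck≡nCk n (ℕ.<-trans (ℕ.n<1+n k) k<Q)) ([Q+n]Ck≡nCk n k<Q) ⟩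
      + (n C k) + + (n C suc k)                  ≡⟨ pascal-ℤ n k ⟨
      + (suc n C suc k)                          ∎

    [l*Q+n]Ck≡nCk : ∀ l n {k} → k < Q → + ((l ℕ.* Q ℕ.+ n) C k) ≡ + (n C k) mod p
    [l*Q+n]Ck≡nCk zero    n k<Q = ≡-mod-refl
    [l*Q+n]Ck≡nCk (suc l) n k<Q rewrite ℕ.+-assoc Q (l ℕ.* Q) n =
      ≡-mod-trans ([Q+n]Ck≡nCk (l ℕ.* Q ℕ.+ n) k<Q) ([l*Q+n]Ck≡nCk l n k<Q)

    [Q-1]Ck≡[-1]^k : ∀ {n} → suc n ≡ Q → ∀ {k} → k < Q → + (n C k) ≡ -1ℤ ^ k mod p
    [Q-1]Ck≡[-1]^k         _      {zero}  _   = ≡-mod-refl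
    [Q-1]Ck≡[-1]^k {n} refl {suc k} k<Q = begin
      + (n C suc k)                                  ≡⟨ y≡[x+y]-x (+ (n C k)) (+ (n C suc k)) ⟩
      (+ (n C k) + + (n C suc k)) - + (n C k)        ≡⟨ cong (_- + (n C k)) (pascal-ℤ n k) ⟨
      + (suc n C suc k) - + (n C k)                  ≈⟨ +-cong-mod (∣⇒≡0-mod (p∣QCk (s≤s z≤n) k<Q))
                                                          (neg-cong-mod ([Q-1]Ck≡[-1]^k refl (ℕ.<-trans (ℕ.n<1+n k) k<Q))) ⟩
      0ℤ - -1ℤ ^ k                                   ≡⟨ +-identityˡ _ ⟩
      - (-1ℤ ^ k)                                    ≡⟨ -1*i≡-i (-1ℤ ^ k) ⟨
      -1ℤ ^ suc k                                    ∎
      where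
      y≡[x+y]-x : ∀ x y → y ≡ (x + y) - x
      y≡[x+y]-x = solve-∀

module BinomialProductModuloPrime where

  open import Data.Nat
  open import Data.Nat.Properties
  open import Data.Nat.Combinatorics using (_C_; nCn≡1; k>n⇒nCk≡0)
  open import Data.Nat.Divisibility using (_∣_)
  open import Data.Nat.Tactic.RingSolver using (solve-∀)
  open import Data.Bool using (true; false; T; if_then_else_)
  open import Data.Integer.Base as ℤ using (+_; 0ℤ; -1ℤ)
  open import Data.Integer.Properties as ℤ using (pos-*)
  open import Relation.Binary.PropositionalEquality
  open import Relation.Binary.Definitions using (tri<; tri≈; tri>)
  open import Relation.Nullary using (¬_; contradiction)
  open Congruence
  open BinomialsModuloPrime

  if-≡ᵇ-yes : ∀ {A : Set} {m n} {x y : A} → m ≡ n → (if m ≡ᵇ n then x else y) ≡ x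
  if-≡ᵇ-yes {m = m} {n} m≡n with m ≡ᵇ n | ≡⇒≡ᵇ m n m≡n
  ... | true | _ = refl

  if-≡ᵇ-no : ∀ {A : Set} {m n} {x y : A} → ¬ m ≡ n → (if m ≡ᵇ n then x else y) ≡ y
  if-≡ᵇ-no {m = m} {n} m≢n with m ≡ᵇ n in eq
  ... | true  = contradiction (≡ᵇ⇒≡ m n (subst T (sym eq) _)) m≢n
  ... | false = refl

  1+c≡lQ+[1+s]⇒c+Q≡[1+l]Q+s : ∀ {c l Q s} → suc c ≡ l * Q + suc s → c + Q ≡ suc l * Q + s
  1+c≡lQ+[1+s]⇒c+Q≡[1+l]Q+s {c} {l} {Q} {s} eq = trans (cong (_+ Q) c≡lQ+s) (x+y+z≡z+x+y (l * Q) s Q)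
    where
    c≡lQ+s : c ≡ l * Q + s
    c≡lQ+s = suc-injective (trans eq (+-suc (l * Q) s))
    x+y+z≡z+x+y : ∀ x y z → x + y + z ≡ z + x + y
    x+y+z≡z+x+y = solve-∀

  module _ {p Q : ℕ} (p∣QCk : ∀ {k} → 0 < k → k < Q → p ∣ Q C k)
           {c l s n J : ℕ} (m≡lQ+s : suc c ≡ l * Q + s) (s<Q : s < Q) (Q≡n+J : Q ≡ suc n + suc J) where

    open ≡-mod-Reasoning p

    1+n<Q : suc n < Q
    1+n<Q = subst (suc n <_) (sym Q≡n+J) (m<m+n (suc n) z<s)

    A B : ℕ
    A = (c + suc n) C suc n
    B = (c + suc n + suc J) C J

    +-*-cong-mod : ∀ {x y} → + A ≡ x mod p → + B ≡ y mod p → + (A * B) ≡ x ℤ.* y mod p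
    +-*-cong-mod {x} {y} A≡x B≡y = begin
      + (A * B)        ≡⟨ pos-* A B ⟩
      + A ℤ.* + B      ≈⟨ *-cong-mod A≡x B≡y ⟩
      x ℤ.* y          ∎

    A≡[s+n]C[1+n] : + A ≡ + ((s + n) C suc n) mod p
    A≡[s+n]C[1+n] = begin
      + ((c + suc n) C suc n)          ≡⟨ cong (λ t → + (t C suc n)) c+[1+n]≡lQ+[s+n] ⟩
      + ((l * Q + (s + n)) C suc n)    ≈⟨ [l*Q+n]Ck≡nCk p∣QCk l (s + n) 1+n<Q ⟩
      + ((s + n) C suc n)              ∎
      where
      c+[1+n]≡lQ+[s+n] : c + suc n ≡ l * Q + (s + n)
      c+[1+n]≡lQ+[s+n] = trans (+-suc c n) (trans (cong (_+ n) m≡lQ+s) (+-assoc (l * Q) s n))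

    B≡s′CJ : ∀ {s′} → s ≡ suc s′ → + B ≡ + (s′ C J) mod p
    B≡s′CJ {s′} refl = begin
      + ((c + suc n + suc J) C J)      ≡⟨ cong (λ t → + (t C J)) c+[1+n]+[1+J]≡[1+l]Q+s′ ⟩
      + ((suc l * Q + s′) C J)         ≈⟨ [l*Q+n]Ck≡nCk p∣QCk (suc l) s′ J<Q ⟩
      + (s′ C J)                       ∎
      where
      c+[1+n]+[1+J]≡[1+l]Q+s′ : c + suc n + suc J ≡ suc l * Q + s′
      c+[1+n]+[1+J]≡[1+l]Q+s′ = trans (+-assoc c (suc n) (suc J))
        (trans (cong (λ t → c + t) (sym Q≡n+J)) (1+c≡lQ+[1+s]⇒c+Q≡[1+l]Q+s {l = l} m≡lQ+s))
      J<Q : J < Q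
      J<Q = subst (J <_) (sym Q≡n+J) (≤-trans (n<1+n J) (m≤n+m (suc J) (suc n)))

    product≡0-if-below : suc n + s < Q → + (A * B) ≡ 0ℤ mod p
    product≡0-if-below 1+n+s<Q = by-cases-on s refl
      where
      by-cases-on : ∀ t → s ≡ t → + (A * B) ≡ 0ℤ mod p
      by-cases-on zero refl = begin
        + (A * B)                       ≈⟨ +-*-cong-mod A≡[s+n]C[1+n] ≡-mod-refl ⟩
        + (n C suc n) ℤ.* + B           ≡⟨ cong (λ t → + t ℤ.* + B) (k>n⇒nCk≡0 (n<1+n n)) ⟩
        0ℤ                              ∎
      by-cases-on (suc s′) s≡1+s′ = begin
        + (A * B)                       ≈⟨ +-*-cong-mod ≡-mod-refl (B≡s′CJ s≡1+s′) ⟩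
        + A ℤ.* + (s′ C J)              ≡⟨ cong (λ t → + A ℤ.* + t) (k>n⇒nCk≡0 s′<J) ⟩
        + A ℤ.* 0ℤ                      ≡⟨ ℤ.*-zeroʳ (+ A) ⟩
        0ℤ                              ∎
        where
        s′<J : s′ < J
        s′<J = s<s⁻¹ (+-cancelˡ-< (suc n) (suc s′) (suc J)
                 (subst₂ (λ t u → suc n + t < u) s≡1+s′ Q≡n+J 1+n+s<Q))

    product≡[-1]^[1+n]-if-at : suc n + s ≡ Q → + (A * B) ≡ -1ℤ ℤ.^ suc n mod p
    product≡[-1]^[1+n]-if-at 1+n+s≡Q = begin
      + (A * B)                       ≈⟨ +-*-cong-mod (≡-mod-trans A≡[s+n]C[1+n] [s+n]C[1+n]≡[-1]^[1+n]) (B≡s′CJ s≡1+J) ⟩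
      -1ℤ ℤ.^ suc n ℤ.* + (J C J)     ≡⟨ cong (λ t → -1ℤ ℤ.^ suc n ℤ.* + t) (nCn≡1 J) ⟩
      -1ℤ ℤ.^ suc n ℤ.* + 1           ≡⟨ ℤ.*-identityʳ _ ⟩
      -1ℤ ℤ.^ suc n                   ∎
      where
      [s+n]C[1+n]≡[-1]^[1+n] : + ((s + n) C suc n) ≡ -1ℤ ℤ.^ suc n mod p
      [s+n]C[1+n]≡[-1]^[1+n] = [Q-1]Ck≡[-1]^k p∣QCk (trans (cong suc (+-comm s n)) 1+n+s≡Q) 1+n<Q
      s≡1+J : s ≡ suc J
      s≡1+J = +-cancelˡ-≡ (suc n) s (suc J) (trans 1+n+s≡Q Q≡n+J)

    product≡0-if-above : Q < suc n + s → + (A * B) ≡ 0ℤ mod p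
    product≡0-if-above Q<1+n+s = begin
      + (A * B)                       ≈⟨ +-*-cong-mod A≡[s+n]C[1+n] ≡-mod-refl ⟩
      + ((s + n) C suc n) ℤ.* + B     ≡⟨ cong (λ t → + (t C suc n) ℤ.* + B) s+n≡Q+u ⟩
      + ((Q + u) C suc n) ℤ.* + B     ≈⟨ *-cong-mod ([Q+n]Ck≡nCk p∣QCk u 1+n<Q) ≡-mod-refl ⟩
      + (u C suc n) ℤ.* + B           ≡⟨ cong (λ t → + t ℤ.* + B) (k>n⇒nCk≡0 (m<n⇒m<1+n u<n)) ⟩
      0ℤ                              ∎
      where
      u : ℕ
      u = s + n ∸ Q
      s+n≡Q+u : s + n ≡ Q + u
      s+n≡Q+u = sym (m+[n∸m]≡n (subst (Q ≤_) (+-comm n s) (s≤s⁻¹ Q<1+n+s)))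
      u<n : u < n
      u<n = +-cancelˡ-< Q u n (subst (_< Q + n) s+n≡Q+u (+-monoˡ-< n s<Q))

    binomial-product-mod : + (A * B) ≡ (if suc n + s ≡ᵇ Q then -1ℤ ℤ.^ suc n else 0ℤ) mod p
    binomial-product-mod with <-cmp (suc n + s) Q
    ... | tri< below ≢ _   rewrite if-≡ᵇ-no {x = -1ℤ ℤ.^ suc n} {0ℤ} ≢ = product≡0-if-below below
    ... | tri≈ _ at _     rewrite if-≡ᵇ-yes {x = -1ℤ ℤ.^ suc n} {0ℤ} at = product≡[-1]^[1+n]-if-at at
    ... | tri> _ ≢ above  rewrite if-≡ᵇ-no {x = -1ℤ ℤ.^ suc n} {0ℤ} ≢ = product≡0-if-above above

open import Data.Nat using (ℕ; _+_; _*_; _∸_; _^_; _≤_; _<_; _≡ᵇ_)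
open import Data.Nat.Primality using (Prime)
open import Data.Nat.Combinatorics using (_C_)
open import Data.Integer using (ℤ; +_; -_; _-_) renaming (_^_ to _^ℤ_)
open import Data.Integer.Divisibility using (_∣_)
open import Data.Bool using (if_then_else_)
open import Relation.Binary.PropositionalEquality using (_≡_)
open import Data.Nat using (suc)
import Data.Nat.Divisibility as ℕ
open import Data.Nat.Properties using (^-*-assoc; +-suc; m+[n∸m]≡n; m+n∸m≡n)
open import Data.Integer.Divisibility.Signed using (∣⇒∣ᵤ)
open import Relation.Binary.PropositionalEquality using (sym; trans; cong; subst)
open BinomialIdentities using (sum-binomial-product)
open PrimePowerBinomials using (p∣[p^e]Ck)
open Congruence using (_≡_mod_; n∣x-y)
open BinomialProductModuloPrime using (binomial-product-mod)

mainTheorem16 : (p a k m l s n : ℕ) → Prime p → 1 ≤ a → 1 ≤ k → 0 < m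
    → m ≡ l * (p ^ a) ^ k + s → s < (p ^ a) ^ k
    → 1 ≤ n → n < (p ^ a) ^ k
    → (+ p) ∣ (+ sumFrom n ((p ^ a) ^ k ∸ n) (λ r → (r C n) * ((m + r ∸ 1) C r))
               - (if (n + s) ≡ᵇ (p ^ a) ^ k then (- + 1) ^ℤ n else + 0))
mainTheorem16 p a k (suc c) l s (suc n) p-prime _ _ _ m≡lQ+s s<Q _ 1+n<Q =
  ∣⇒∣ᵤ (n∣x-y (subst (λ t → + t ≡ expected mod p) (sym sum≡product)
    (binomial-product-mod p∣QCk {l = l} m≡lQ+s s<Q Q≡n+J)))
  where
  Q J : ℕ
  Q = (p ^ a) ^ k
  J = Q ∸ suc (suc n)
  expected : ℤ
  expected = if suc n + s ≡ᵇ Q then (- + 1) ^ℤ suc n else + 0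
  term : ℕ → ℕ
  term r = (r C suc n) * ((c + r) C r)
  Q≡n+J : Q ≡ suc n + suc J
  Q≡n+J = sym (trans (cong suc (+-suc n J)) (m+[n∸m]≡n 1+n<Q))
  p∣QCk : ∀ {i} → 0 < i → i < Q → p ℕ.∣ Q C i
  p∣QCk {i} 0<i i<Q = subst (λ q → p ℕ.∣ q C i) (sym (^-*-assoc p a k))
    (p∣[p^e]Ck p-prime (a * k) 0<i (subst (i <_) (^-*-assoc p a k) i<Q))
  Q∸n≡1+J : Q ∸ suc n ≡ suc J
  Q∸n≡1+J = trans (cong (_∸ suc n) Q≡n+J) (m+n∸m≡n (suc n) (suc J))
  sum≡product : sumFrom (suc n) (Q ∸ suc n) term ≡ ((c + suc n) C suc n) * ((c + suc n + suc J) C J)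
  sum≡product = trans (cong (λ len → sumFrom (suc n) len term) Q∸n≡1+J) (sum-binomial-product c (suc n) J)
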